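{- There is a constant $C>0$ such that for every integer $n\ge 1$ and every string $S=S[1..n]$ of length $n$ over an alphabet $\Sigma$, the number of maximal closed substrings of $S$ (i.e., the number of pairs $(i,j)$ with $1\le i\le j\le n$ such that $S[i..j]$ is a maximal closed substring of $S$) is at most $C\, n^{1.5}$. That is, a string of length $n$ contains $\mathcal O(n^{1.5})$ maximal closed substrings.
   Context: For a string $S=S[1]\cdots S[n]$ and $1\le i\le j\le n$, $S[i..j]=S[i]S[i+1]\cdots S[j]$. A border of a string $w$ is a string $\beta\neq w$ (possibly empty) that is both a prefix and a suffix of $w$. A string $w$ is closed if $|w|=1$ or $w$ has a nonempty border $\beta$ that occurs in $w$ only as a prefix and as a suffix (i.e., $\beta$ has exactly two occurrences in $w$, starting at positions $1$ and $|w|-|\beta|+1$). A maximal closed substring (MCS) of $S$ is an occurrence $S[i..j]$, $1\le i\le j\le n$, such that $S[i..j]$ is closed, and either $i=1$ or $S[i-1..j]$ is not closed, and either $j=n$ or $S[i..j+1]$ is not closed (i.e., it cannot be extended by one position to the left or to the right into a closed substring). Distinct MCSs are distinct pairs $(i,j)$. -}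

module Defs where

open import Data.Nat using (ℕ; suc; _+_; _∸_; _≤_; _<_)
open import Data.List using (List; length; take; drop)
open import Data.Product using (Σ; _×_; ∃-syntax)
open import Data.Sum using (_⊎_)
open import Relation.Binary.PropositionalEquality using (_≡_)
open import Relation.Nullary using (¬_)

-- Strings over an alphabet A are lists; positions in occurrences are 0-based here.

OccursAt : {A : Set} → List A → List A → ℕ → Set
OccursAt β w k = (k + length β ≤ length w) × (take (length β) (drop k w) ≡ β)

-- β is a border of w: β ≠ w (equivalently |β| < |w| for prefixes), prefix and suffix.
IsBorder : {A : Set} → List A → List A → Set
IsBorder β w = (length β < length w) × OccursAt β w 0 × OccursAt β w (length w ∸ length β)

Closed : {A : Set} → List A → Set
Closed w = (length w ≡ 1)
         ⊎ (∃[ β ] (0 < length β × IsBorder β w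
                    × (∀ k → OccursAt β w k → (k ≡ 0) ⊎ (k ≡ length w ∸ length β))))

-- S[i..j] with 1-based inclusive indices.
substr : {A : Set} → List A → ℕ → ℕ → List A
substr S i j = take (suc j ∸ i) (drop (i ∸ 1) S)

IsMCS : {A : Set} → List A → ℕ → ℕ → Set
IsMCS S i j = (1 ≤ i) × (i ≤ j) × (j ≤ length S)
            × Closed (substr S i j)
            × ((i ≡ 1) ⊎ ¬ Closed (substr S (i ∸ 1) j))
            × ((j ≡ length S) ⊎ ¬ Closed (substr S i (suc j)))

{-# OPTIONS --safe #-}
-- Write a closed factor as a border of length ℓ that recurs after q positions and nowhere in
-- between, and fix m = ⌊√n⌋.  A start position and a border length determine q (the recurrence is
-- the first one), so at most n·m maximal closed factors have ℓ < m.  Two maximal closed factors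
-- with the same q, borders of length ≥ m and starts in the same block of m consecutive positions
-- coincide: if the starts differ, the later one starts inside the border of the earlier one and
-- extends one letter to the left; if the starts agree, the shorter one extends one letter to the
-- right.  So at most (n/m + 1)·n have ℓ ≥ m, and the total is O(n·m) = O(n^1.5).
module Submission where

open import Defs
open import Data.Empty using (⊥; ⊥-elim)
open import Data.Fin as Fin using (Fin; fromℕ<)
import Data.Fin.Properties as Finₚ
open import Data.List using (List; []; _∷_; length; take; drop; lookup)
open import Data.List.Properties using (length-take; length-drop)
open import Data.List.Membership.Propositional.Properties using (∈-lookup)
open import Data.List.Relation.Unary.All as All using (All)
open import Data.List.Relation.Unary.AllPairs using (_∷_)
open import Data.List.Relation.Unary.Unique.Propositional using (Unique)
open import Data.Maybe using (Maybe; just; nothing)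
open import Data.Nat using (ℕ; zero; suc; _+_; _*_; _∸_; _^_; _/_; _%_; _⊓_; _≤_; _<_; _<?_; z≤n; s≤s; z<s; NonZero)
open import Data.Nat.DivMod using (m≡m%n+[m/n]*n; m%n<n; m/n*n≤m; /-monoˡ-≤; m<n*o⇒m/o<n)
open import Data.Nat.Properties
open import Data.Nat.Tactic.RingSolver using (solve-∀)
open import Data.Product using (_×_; _,_; proj₁; ∃-syntax; uncurry)
open import Data.Product.Properties using (,-injective)
open import Data.Sum as Sum using (_⊎_; inj₁; inj₂; [_,_]′)
open import Data.Sum.Properties using (inj₁-injective; inj₂-injective)
open import Data.Sum.Function.Propositional using (_⊎-↔_)
open import Data.Vec using (Vec; toList)
open import Data.Vec.Properties using (length-toList)
open import Function using (_↔_; Inverse; Injection)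
open import Function.Properties.Inverse using (↔-refl; ↔-sym; ↔-trans; ↔⇒↣)
open import Relation.Binary.Definitions using (tri<; tri≈; tri>)
open import Relation.Binary.PropositionalEquality
open import Relation.Nullary using (¬_; Dec; yes; no; contradiction)

private
  variable
    A X : Set
    a a' q q' ℓ ℓ' i i' j j' k L : ℕ
    f g : ℕ → Maybe A

Unique⇒lookup-injective : {xs : List X} → Unique xs → ∀ {i j} → lookup xs i ≡ lookup xs j → i ≡ j
Unique⇒lookup-injective (x∉xs ∷ _) {Fin.zero}  {Fin.zero}  _ = refl
Unique⇒lookup-injective (x∉xs ∷ _) {Fin.zero}  {Fin.suc j} x≡ = contradiction x≡ (All.lookup x∉xs (∈-lookup j))
Unique⇒lookup-injective (x∉xs ∷ _) {Fin.suc i} {Fin.zero}  ≡x = contradiction (sym ≡x) (All.lookup x∉xs (∈-lookup i))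
Unique⇒lookup-injective (_ ∷ unique) {Fin.suc i} {Fin.suc j} eq = cong Fin.suc (Unique⇒lookup-injective unique eq)

length≤-by-injection : ∀ {P : X → Set} {N} {xs : List X} (f : ∀ {x} → P x → Fin N)
                     → (∀ {x y} (p : P x) (p' : P y) → f p ≡ f p' → x ≡ y)
                     → Unique xs → All P xs → length xs ≤ N
length≤-by-injection f f-injective unique ps = ≮⇒≥ λ N<|xs| →
  let i , j , i<j , fi≡fj = Finₚ.pigeonhole N<|xs| (λ i → f (All.lookup ps (∈-lookup i)))
  in Finₚ.<⇒≢ i<j (Unique⇒lookup-injective unique (f-injective _ _ fi≡fj))

m/n≡o/n⇒o<m+n : ∀ m n o .{{_ : NonZero n}} → m / n ≡ o / n → o < m + n
m/n≡o/n⇒o<m+n m n o m/n≡o/n = begin-strict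
  o                 ≡⟨ m≡m%n+[m/n]*n o n ⟩
  o % n + o / n * n <⟨ +-monoˡ-< (o / n * n) (m%n<n o n) ⟩
  n + o / n * n     ≡⟨ cong (λ d → n + d * n) m/n≡o/n ⟨
  n + m / n * n     ≤⟨ +-monoʳ-≤ n (m/n*n≤m m n) ⟩
  n + m             ≡⟨ +-comm n m ⟩
  m + n             ∎
  where open ≤-Reasoning

-- Positions past the end all read as nothing, so factor statements carry their own bounds.
at : List A → ℕ → Maybe A
at []       _       = nothing
at (x ∷ xs) zero    = just x
at (x ∷ xs) (suc k) = at xs k

at-take : (xs : List A) → k < L → at (take L xs) k ≡ at xs k
at-take {k = k}     {suc L} []       _         = refl
at-take {k = zero}  {suc L} (x ∷ xs) _         = refl
at-take {k = suc k} {suc L} (x ∷ xs) (s≤s k<L) = at-take xs k<L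

at-drop : ∀ a (xs : List A) k → at (drop a xs) k ≡ at xs (a + k)
at-drop zero    xs       k = refl
at-drop (suc a) []       k = refl
at-drop (suc a) (x ∷ xs) k = at-drop a xs k

at-factor : (xs : List A) → k < L → at (take L (drop a xs)) k ≡ at xs (a + k)
at-factor {a = a} xs k<L = trans (at-take (drop a xs) k<L) (at-drop a xs _)

length-factor : (xs : List A) → a + L ≤ length xs → length (take L (drop a xs)) ≡ L
length-factor {a = a} {L} xs a+L≤n = begin
  length (take L (drop a xs)) ≡⟨ length-take L (drop a xs) ⟩
  L ⊓ length (drop a xs)      ≡⟨ cong (L ⊓_) (length-drop a xs) ⟩
  L ⊓ (length xs ∸ a)         ≡⟨ m≤n⇒m⊓n≡m (subst (_≤ length xs ∸ a) (m+n∸m≡n a L) (∸-monoˡ-≤ a a+L≤n)) ⟩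
  L                           ∎
  where open ≡-Reasoning

at-ext : {xs ys : List A} → length xs ≡ length ys → (∀ {k} → k < length xs → at xs k ≡ at ys k) → xs ≡ ys
at-ext {xs = []}     {[]}     _         _     = refl
at-ext {xs = x ∷ xs} {y ∷ ys} |xs|≡|ys| agree with agree {0} z<s
... | refl = cong (x ∷_) (at-ext (suc-injective |xs|≡|ys|) (λ k<n → agree (s≤s k<n)))

OccursAt⇒at : {β w : List A} → OccursAt β w k → ∀ {t} → t < length β → at w (k + t) ≡ at β t
OccursAt⇒at {w = w} (_ , factor≡β) t<|β| = trans (sym (at-factor w t<|β|)) (cong (λ v → at v _) factor≡β)

at⇒OccursAt : {β w : List A} → k + length β ≤ length w → (∀ {t} → t < length β → at w (k + t) ≡ at β t)
            → OccursAt β w k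
at⇒OccursAt {k = k} {β = β} {w} fits agree = fits , at-ext |factor|≡|β| agree′
  where
  factor = take (length β) (drop k w)
  |factor|≡|β| = length-factor w fits
  agree′ : ∀ {t} → t < length factor → at factor t ≡ at β t
  agree′ t<|factor| = let t<|β| = subst (_ <_) |factor|≡|β| t<|factor| in
    trans (at-factor w t<|β|) (agree t<|β|)

EqualFactors : (ℕ → Maybe A) → ℕ → ℕ → ℕ → Set
EqualFactors f ℓ b c = ∀ {t} → t < ℓ → f (b + t) ≡ f (c + t)

EqualFactors-tail : ∀ {b c} → EqualFactors f (suc ℓ) b c → EqualFactors f ℓ (suc b) (suc c)
EqualFactors-tail {f = f} {b = b} {c} eq {t} t<ℓ =
  trans (cong f (sym (+-suc b t))) (trans (eq (s≤s t<ℓ)) (cong f (+-suc c t)))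

EqualFactors-cons : ∀ {b c} → f b ≡ f c → EqualFactors f ℓ (suc b) (suc c) → EqualFactors f (suc ℓ) b c
EqualFactors-cons {f = f} {b = b} {c} head tail {zero} _ =
  trans (cong f (+-identityʳ b)) (trans head (cong f (sym (+-identityʳ c))))
EqualFactors-cons {f = f} {b = b} {c} head tail {suc t} (s≤s t<ℓ) =
  trans (cong f (+-suc b t)) (trans (tail t<ℓ) (cong f (sym (+-suc c t))))

-- The factor f[a, a + q + ℓ) is closed: its border of length ℓ recurs at offset q and at no
-- offset in between.
record ClosedAt (f : ℕ → Maybe A) (a q ℓ : ℕ) : Set where
  field
    border-nonempty : 0 < ℓ
    period-nonzero  : 0 < q
    border-recurs   : EqualFactors f ℓ a (a + q)
    border-unique   : ∀ {k} → k ≤ q → EqualFactors f ℓ (a + k) a → k ≡ 0 ⊎ k ≡ q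
open ClosedAt

border-not-inside : ClosedAt f a q ℓ → 0 < k → k < q → ¬ EqualFactors f ℓ (a + k) a
border-not-inside c 0<k k<q eq with border-unique c (<⇒≤ k<q) eq
... | inj₁ k≡0 = <⇒≢ 0<k (sym k≡0)
... | inj₂ k≡q = <⇒≢ k<q k≡q

ClosedAt-period-unique : ClosedAt f a q ℓ → ClosedAt f a q' ℓ → q ≡ q'
ClosedAt-period-unique {q = q} {q' = q'} c c' with <-cmp q q'
... | tri< q<q' _ _ = ⊥-elim (border-not-inside c' (period-nonzero c) q<q' (λ t<ℓ → sym (border-recurs c t<ℓ)))
... | tri≈ _ q≡q' _ = q≡q'
... | tri> _ _ q'<q = ⊥-elim (border-not-inside c (period-nonzero c') q'<q (λ t<ℓ → sym (border-recurs c' t<ℓ)))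

ClosedAt-extendˡ : ClosedAt f (suc a) q ℓ → f a ≡ f (a + q) → ClosedAt f a q (suc ℓ)
ClosedAt-extendˡ {f = f} {a = a} {q = q} c first = record
  { border-nonempty = z<s
  ; period-nonzero  = period-nonzero c
  ; border-recurs   = EqualFactors-cons {f = f} {b = a} {a + q} first (border-recurs c)
  ; border-unique   = λ {k} k≤q eq → border-unique c k≤q (EqualFactors-tail {f = f} {b = a + k} {a} eq)
  }

ClosedAt-extendʳ : ClosedAt f a q ℓ → f (a + ℓ) ≡ f (a + q + ℓ) → ClosedAt f a q (suc ℓ)
ClosedAt-extendʳ {f = f} {a = a} {q = q} {ℓ = ℓ} c last = record
  { border-nonempty = z<s
  ; period-nonzero  = period-nonzero c
  ; border-recurs   = recurs
  ; border-unique   = λ k≤q eq → border-unique c k≤q (λ t<ℓ → eq (m≤n⇒m≤1+n t<ℓ))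
  }
  where
  recurs : EqualFactors f (suc ℓ) a (a + q)
  recurs t<1+ℓ with m<1+n⇒m<n∨m≡n t<1+ℓ
  ... | inj₁ t<ℓ = border-recurs c t<ℓ
  ... | inj₂ refl = last

ClosedAt-transport : ∀ {b} → (∀ {t} → t < q + ℓ → f (a + t) ≡ g (b + t)) → ClosedAt f a q ℓ → ClosedAt g b q ℓ
ClosedAt-transport {q = q} {ℓ = ℓ} {f = f} {a = a} {g = g} {b} agree c = record
  { border-nonempty = border-nonempty c
  ; period-nonzero  = period-nonzero c
  ; border-recurs   = recurs
  ; border-unique   = λ k≤q eq → border-unique c k≤q (pull k≤q eq)
  }
  where
  open ≡-Reasoning
  recurs : EqualFactors g ℓ b (b + q)
  recurs {t} t<ℓ = begin
    g (b + t)       ≡⟨ agree (<-≤-trans t<ℓ (m≤n+m ℓ q)) ⟨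
    f (a + t)       ≡⟨ border-recurs c t<ℓ ⟩
    f (a + q + t)   ≡⟨ cong f (+-assoc a q t) ⟩
    f (a + (q + t)) ≡⟨ agree (+-monoʳ-< q t<ℓ) ⟩
    g (b + (q + t)) ≡⟨ cong g (+-assoc b q t) ⟨
    g (b + q + t)   ∎
  pull : ∀ {k} → k ≤ q → EqualFactors g ℓ (b + k) b → EqualFactors f ℓ (a + k) a
  pull {k} k≤q eq {t} t<ℓ = begin
    f (a + k + t)   ≡⟨ cong f (+-assoc a k t) ⟩
    f (a + (k + t)) ≡⟨ agree (+-mono-≤-< k≤q t<ℓ) ⟩
    g (b + (k + t)) ≡⟨ cong g (+-assoc b k t) ⟨
    g (b + k + t)   ≡⟨ eq t<ℓ ⟩
    g (b + t)       ≡⟨ agree (<-≤-trans t<ℓ (m≤n+m ℓ q)) ⟨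
    f (a + t)       ∎

Closed⇒ClosedAt : {w : List A} → Closed w
                → length w ≡ 1 ⊎ ∃[ q ] ∃[ ℓ ] (q + ℓ ≡ length w × ClosedAt (at w) 0 q ℓ)
Closed⇒ClosedAt (inj₁ |w|≡1) = inj₁ |w|≡1
Closed⇒ClosedAt {w = w} (inj₂ (β , 0<|β| , (|β|<|w| , prefix , suffix) , only)) =
  inj₂ (length w ∸ length β , length β , m∸n+n≡m (<⇒≤ |β|<|w|) , record
    { border-nonempty = 0<|β|
    ; period-nonzero  = m<n⇒0<n∸m |β|<|w|
    ; border-recurs   = λ t<ℓ → trans (OccursAt⇒at prefix t<ℓ) (sym (OccursAt⇒at suffix t<ℓ))
    ; border-unique   = λ k≤q eq → only _ (at⇒OccursAt (fits k≤q) (λ t<ℓ → trans (eq t<ℓ) (OccursAt⇒at prefix t<ℓ)))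
    })
  where
  fits : k ≤ length w ∸ length β → k + length β ≤ length w
  fits k≤q = ≤-trans (+-monoˡ-≤ (length β) k≤q) (≤-reflexive (m∸n+n≡m (<⇒≤ |β|<|w|)))

border⇒Closed : {w β : List A} → q + length β ≡ length w → (∀ {t} → t < length β → at w t ≡ at β t)
              → ClosedAt (at w) 0 q (length β) → Closed w
border⇒Closed {q = q} {w = w} {β} q+|β|≡|w| prefix c =
  inj₂ (β , border-nonempty c , (|β|<|w| , at⇒OccursAt (<⇒≤ |β|<|w|) prefix , suffix) , only)
  where
  q≡|w|∸|β| : q ≡ length w ∸ length β
  q≡|w|∸|β| = trans (sym (m+n∸n≡m q (length β))) (cong (_∸ length β) q+|β|≡|w|)
  |β|<|w| : length β < length w
  |β|<|w| = subst (length β <_) (trans (+-comm (length β) q) q+|β|≡|w|) (m<m+n (length β) (period-nonzero c))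
  suffix : OccursAt β w (length w ∸ length β)
  suffix = subst (OccursAt β w) q≡|w|∸|β|
    (at⇒OccursAt (≤-reflexive q+|β|≡|w|) (λ t<ℓ → trans (sym (border-recurs c t<ℓ)) (prefix t<ℓ)))
  only : ∀ k → OccursAt β w k → k ≡ 0 ⊎ k ≡ length w ∸ length β
  only k occ = Sum.map₂ (λ k≡q → trans k≡q q≡|w|∸|β|)
    (border-unique c (+-cancelʳ-≤ _ k q (subst (k + length β ≤_) (sym q+|β|≡|w|) (proj₁ occ)))
                     (λ t<ℓ → trans (OccursAt⇒at occ t<ℓ) (sym (prefix t<ℓ))))

Closed-factor⇒ClosedAt : (xs : List A) → a + L ≤ length xs → Closed (take L (drop a xs))
                       → L ≡ 1 ⊎ ∃[ q ] ∃[ ℓ ] (q + ℓ ≡ L × ClosedAt (at xs) a q ℓ)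
Closed-factor⇒ClosedAt xs fits closed with Closed⇒ClosedAt closed
... | inj₁ |w|≡1 = inj₁ (trans (sym (length-factor xs fits)) |w|≡1)
... | inj₂ (q , ℓ , q+ℓ≡|w| , c) = inj₂ (q , ℓ , q+ℓ≡L ,
        ClosedAt-transport (λ t<q+ℓ → at-factor xs (subst (_ <_) q+ℓ≡L t<q+ℓ)) c)
  where q+ℓ≡L = trans q+ℓ≡|w| (length-factor xs fits)

ClosedAt⇒Closed-factor : (xs : List A) → a + (q + ℓ) ≤ length xs → ClosedAt (at xs) a q ℓ
                       → Closed (take (q + ℓ) (drop a xs))
ClosedAt⇒Closed-factor {a = a} {q = q} {ℓ = ℓ} xs fits c =
  border⇒Closed {β = take ℓ (drop a xs)} (trans (cong (q +_) |β|≡ℓ) (sym (length-factor {a = a} xs fits))) prefix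
    (ClosedAt-transport (λ {t} t<q+|β| → sym (at-factor {a = a} xs (subst (t <_) q+|β|≡q+ℓ t<q+|β|)))
      (subst (ClosedAt (at xs) a q) (sym |β|≡ℓ) c))
  where
  |β|≡ℓ : length (take ℓ (drop a xs)) ≡ ℓ
  |β|≡ℓ = length-factor {a = a} xs (≤-trans (+-monoʳ-≤ a (m≤n+m ℓ q)) fits)
  q+|β|≡q+ℓ = cong (q +_) |β|≡ℓ
  prefix : ∀ {t} → t < length (take ℓ (drop a xs)) → at (take (q + ℓ) (drop a xs)) t ≡ at (take ℓ (drop a xs)) t
  prefix t<|β| = let t<ℓ = subst (_ <_) |β|≡ℓ t<|β| in
    trans (at-factor {a = a} xs (<-≤-trans t<ℓ (m≤n+m ℓ q))) (sym (at-factor {a = a} xs t<ℓ))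

-- Weaker than maximality: only the one-letter extensions that keep the period q are excluded.
record MaximalClosedAt (xs : List A) (a q ℓ : ℕ) : Set where
  field
    closed        : ClosedAt (at xs) a q ℓ
    fits          : a + (q + ℓ) ≤ length xs
    left-maximal  : ∀ {a'} → a ≡ suc a' → ¬ ClosedAt (at xs) a' q (suc ℓ)
    right-maximal : a + (q + ℓ) < length xs → ¬ ClosedAt (at xs) a q (suc ℓ)
open MaximalClosedAt

ClosedAt⇒Closed-substr : (xs : List A) → a + (q + ℓ) ≡ j → j ≤ length xs → ClosedAt (at xs) a q ℓ
                       → Closed (take (j ∸ a) (drop a xs))
ClosedAt⇒Closed-substr {a = a} {q = q} {ℓ = ℓ} xs refl fits c =
  subst (λ L → Closed (take L (drop a xs))) (sym (m+n∸m≡n a (q + ℓ))) (ClosedAt⇒Closed-factor xs fits c)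

IsMCS⇒MaximalClosedAt : {xs : List A} → IsMCS xs (suc a) j → a + (q + ℓ) ≡ j → ClosedAt (at xs) a q ℓ
                      → MaximalClosedAt xs a q ℓ
IsMCS⇒MaximalClosedAt {a = a} {q = q} {ℓ = ℓ} {xs} (_ , _ , j≤n , _ , left , right) refl c = record
  { closed        = c
  ; fits          = j≤n
  ; left-maximal  = left-maximal′
  ; right-maximal = right-maximal′
  }
  where
  one-more : ∀ a → a + (q + suc ℓ) ≡ suc (a + (q + ℓ))
  one-more a = trans (cong (a +_) (+-suc q ℓ)) (+-suc a (q + ℓ))
  left-maximal′ : ∀ {a'} → a ≡ suc a' → ¬ ClosedAt (at xs) a' q (suc ℓ)
  left-maximal′ {a'} refl c' =
    [ (λ ()) , (λ ¬closed → ¬closed (ClosedAt⇒Closed-substr xs (one-more a') j≤n c')) ]′ left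
  right-maximal′ : a + (q + ℓ) < length xs → ¬ ClosedAt (at xs) a q (suc ℓ)
  right-maximal′ j<n c' =
    [ <⇒≢ j<n , (λ ¬closed → ¬closed (ClosedAt⇒Closed-substr xs (one-more a) j<n c')) ]′ right

shorter-MaximalClosedAt-extends : {xs : List A} → MaximalClosedAt xs a q ℓ → MaximalClosedAt xs a q ℓ' → ℓ < ℓ' → ⊥
shorter-MaximalClosedAt-extends {a = a} {q = q} M M' ℓ<ℓ' =
  right-maximal M (<-≤-trans (+-monoʳ-< a (+-monoʳ-< q ℓ<ℓ')) (fits M'))
    (ClosedAt-extendʳ (closed M) (border-recurs (closed M') ℓ<ℓ'))

MaximalClosedAt-border-unique : {xs : List A} → MaximalClosedAt xs a q ℓ → MaximalClosedAt xs a q ℓ' → ℓ ≡ ℓ'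
MaximalClosedAt-border-unique {ℓ = ℓ} {ℓ' = ℓ'} M M' with <-cmp ℓ ℓ'
... | tri< ℓ<ℓ' _ _ = ⊥-elim (shorter-MaximalClosedAt-extends M M' ℓ<ℓ')
... | tri≈ _ ℓ≡ℓ' _ = ℓ≡ℓ'
... | tri> _ _ ℓ'<ℓ = ⊥-elim (shorter-MaximalClosedAt-extends M' M ℓ'<ℓ)

no-MaximalClosedAt-starting-in-border : {xs : List A} → MaximalClosedAt xs a q ℓ → MaximalClosedAt xs a' q ℓ'
                                      → a < a' → a' ≤ a + ℓ → ⊥
no-MaximalClosedAt-starting-in-border {a = a} {q = q} {ℓ = ℓ} {xs = xs} M M' a<a' a'≤a+ℓ
  with m≤n⇒∃[o]m+o≡n a<a'
... | t , refl = left-maximal M' refl (ClosedAt-extendˡ (closed M') first)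
  where
  open ≡-Reasoning
  first : at xs (a + t) ≡ at xs (a + t + q)
  first = begin
    at xs (a + t)       ≡⟨ border-recurs (closed M) (+-cancelˡ-< a t ℓ a'≤a+ℓ) ⟩
    at xs (a + q + t)   ≡⟨ cong (at xs) (+-assoc a q t) ⟩
    at xs (a + (q + t)) ≡⟨ cong (λ d → at xs (a + d)) (+-comm q t) ⟩
    at xs (a + (t + q)) ≡⟨ cong (at xs) (+-assoc a t q) ⟨
    at xs (a + t + q)   ∎

-- IsMCS counts positions from 1, the factor predicates from 0: the MCS (suc a, j) starts at a.
data MCSView (xs : List A) : ℕ → ℕ → Set where
  singleton : a < length xs → MCSView xs (suc a) (suc a)
  bordered  : MaximalClosedAt xs a q ℓ → MCSView xs (suc a) (a + (q + ℓ))

mcsView : {xs : List A} {i j : ℕ} → IsMCS xs i j → MCSView xs i j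
mcsView {xs = xs} {i = suc a} {j = j} mcs@(_ , a<j , j≤n , factor-closed , _) =
  view (Closed-factor⇒ClosedAt xs (subst (_≤ length xs) (sym a+[j∸a]≡j) j≤n) factor-closed)
  where
  a+[j∸a]≡j : a + (j ∸ a) ≡ j
  a+[j∸a]≡j = m+[n∸m]≡n (<⇒≤ a<j)
  view : j ∸ a ≡ 1 ⊎ ∃[ q ] ∃[ ℓ ] (q + ℓ ≡ j ∸ a × ClosedAt (at xs) a q ℓ) → MCSView xs (suc a) j
  view (inj₁ j∸a≡1) = subst (MCSView xs (suc a)) 1+a≡j (singleton (<-≤-trans a<j j≤n))
    where 1+a≡j = trans (+-comm 1 a) (trans (cong (a +_) (sym j∸a≡1)) a+[j∸a]≡j)
  view (inj₂ (q , ℓ , q+ℓ≡j∸a , c)) = subst (MCSView xs (suc a)) a+[q+ℓ]≡j (bordered (IsMCS⇒MaximalClosedAt mcs a+[q+ℓ]≡j c))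
    where a+[q+ℓ]≡j = trans (cong (a +_) q+ℓ≡j∸a) a+[j∸a]≡j

module MCSCount {A : Set} (xs : List A) (m : ℕ) .{{_ : NonZero m}} where

  private
    n = length xs

  blocks : ℕ
  blocks = suc (n / m)

  Code : Set
  Code = Fin n ⊎ (Fin n × Fin m) ⊎ (Fin blocks × Fin n)

  start<n : MaximalClosedAt xs a q ℓ → a < n
  start<n {a = a} {q = q} {ℓ = ℓ} M =
    <-≤-trans (m<m+n a (<-≤-trans (border-nonempty (closed M)) (m≤n+m ℓ q))) (fits M)

  period<n : MaximalClosedAt xs a q ℓ → q < n
  period<n {a = a} {q = q} {ℓ = ℓ} M =
    <-≤-trans (m<m+n q (border-nonempty (closed M))) (≤-trans (m≤n+m (q + ℓ) a) (fits M))

  block<blocks : MaximalClosedAt xs a q ℓ → a / m < blocks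
  block<blocks M = s≤s (/-monoˡ-≤ m (<⇒≤ (start<n M)))

  long-borders-coincide : MaximalClosedAt xs a q ℓ → MaximalClosedAt xs a' q ℓ' → m ≤ ℓ → m ≤ ℓ'
                        → a / m ≡ a' / m → a ≡ a' × ℓ ≡ ℓ'
  long-borders-coincide {a = a} {a' = a'} M M' m≤ℓ m≤ℓ' same-block with <-cmp a a'
  ... | tri< a<a' _ _ = ⊥-elim (no-MaximalClosedAt-starting-in-border M M' a<a'
          (≤-trans (<⇒≤ (m/n≡o/n⇒o<m+n a m a' same-block)) (+-monoʳ-≤ a m≤ℓ)))
  ... | tri≈ _ refl _ = refl , MaximalClosedAt-border-unique M M'
  ... | tri> _ _ a'<a = ⊥-elim (no-MaximalClosedAt-starting-in-border M' M a'<a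
          (≤-trans (<⇒≤ (m/n≡o/n⇒o<m+n a' m a (sym same-block))) (+-monoʳ-≤ a' m≤ℓ')))

  borderedCode : MaximalClosedAt xs a q ℓ → Dec (ℓ < m) → (Fin n × Fin m) ⊎ (Fin blocks × Fin n)
  borderedCode M (yes ℓ<m) = inj₁ (fromℕ< (start<n M) , fromℕ< ℓ<m)
  borderedCode M (no _)    = inj₂ (fromℕ< (block<blocks M) , fromℕ< (period<n M))

  borderedCode-injective : (M : MaximalClosedAt xs a q ℓ) (M' : MaximalClosedAt xs a' q' ℓ')
                           (short? : Dec (ℓ < m)) (short?' : Dec (ℓ' < m))
                         → borderedCode M short? ≡ borderedCode M' short?' → (a , q , ℓ) ≡ (a' , q' , ℓ')
  borderedCode-injective M M' (yes _) (yes _) eq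
    with ,-injective (inj₁-injective eq)
  ... | start≡ , border≡
    with Finₚ.fromℕ<-injective _ _ _ _ start≡ | Finₚ.fromℕ<-injective _ _ _ _ border≡
  ... | refl | refl with ClosedAt-period-unique (closed M) (closed M')
  ... | refl = refl
  borderedCode-injective M M' (no ℓ≮m) (no ℓ'≮m) eq
    with ,-injective (inj₂-injective eq)
  ... | block≡ , period≡
    with Finₚ.fromℕ<-injective _ _ _ _ period≡
  ... | refl with long-borders-coincide M M' (≮⇒≥ ℓ≮m) (≮⇒≥ ℓ'≮m) (Finₚ.fromℕ<-injective _ _ _ _ block≡)
  ... | refl , refl = refl

  code : MCSView xs i j → Code
  code (singleton a<n)      = inj₁ (fromℕ< a<n)
  code (bordered {ℓ = ℓ} M) = inj₂ (borderedCode M (ℓ <? m))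

  code-injective : (v : MCSView xs i j) (v' : MCSView xs i' j') → code v ≡ code v' → (i , j) ≡ (i' , j')
  code-injective (singleton _) (singleton _) eq with Finₚ.fromℕ<-injective _ _ _ _ (inj₁-injective eq)
  ... | refl = refl
  code-injective (bordered M) (bordered M') eq
    with borderedCode-injective M M' (_ <? m) (_ <? m) (inj₂-injective eq)
  ... | refl = refl

  Code↔Fin : Code ↔ Fin (n + (n * m + blocks * n))
  Code↔Fin = ↔-sym (↔-trans Finₚ.+↔⊎ (↔-refl ⊎-↔ ↔-trans Finₚ.+↔⊎ (Finₚ.*↔× ⊎-↔ Finₚ.*↔×)))

  mcs-count : {L : List (ℕ × ℕ)} → Unique L → All (uncurry (IsMCS xs)) L → length L ≤ n + (n * m + blocks * n)
  mcs-count = length≤-by-injection encode encode-injective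
    where
    encode : ∀ {x} → uncurry (IsMCS xs) x → Fin (n + (n * m + blocks * n))
    encode {_ , _} mcs = Inverse.to Code↔Fin (code (mcsView mcs))
    encode-injective : ∀ {x y} (p : uncurry (IsMCS xs) x) (p' : uncurry (IsMCS xs) y) → encode p ≡ encode p' → x ≡ y
    encode-injective {_ , _} {_ , _} mcs mcs' eq =
      code-injective (mcsView mcs) (mcsView mcs') (Injection.injective (↔⇒↣ Code↔Fin) eq)

floor-sqrt : ∀ n → ∃[ m ] (m * m ≤ n × n < suc m * suc m)
floor-sqrt zero = 0 , z≤n , z<s
floor-sqrt (suc n) with floor-sqrt n
... | m , m²≤n , n<[1+m]² with suc n <? suc m * suc m
...   | yes 1+n<[1+m]² = m , m≤n⇒m≤1+n m²≤n , 1+n<[1+m]²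
...   | no  1+n≮[1+m]² = suc m , ≮⇒≥ 1+n≮[1+m]² , ≤-<-trans n<[1+m]² (*-mono-< (n<1+n (suc m)) (n<1+n (suc m)))

mcs-count≤6nm : ∀ n m → n < suc (suc m) * suc (suc m)
              → n + (n * suc m + suc (n / suc m) * n) ≤ 6 * (n * suc m)
mcs-count≤6nm n k n<[2+k]² = begin
  n + (n * m + suc (n / m) * n)     ≤⟨ +-mono-≤ (m≤m*n n m) (+-monoʳ-≤ (n * m) (*-monoˡ-≤ n blocks≤4m)) ⟩
  n * m + (n * m + 4 * m * n)       ≡⟨ sum≡ n m ⟩
  6 * (n * m)                       ∎
  where
  open ≤-Reasoning
  m = suc k
  sum≡ : ∀ n m → n * m + (n * m + 4 * m * n) ≡ 6 * (n * m)
  sum≡ = solve-∀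
  [2+k]²≡[m+3]m∸k : ∀ k → suc (suc k) * suc (suc k) + k ≡ (suc k + 3) * suc k
  [2+k]²≡[m+3]m∸k = solve-∀
  m+3≤4m : ∀ k → suc k + 3 + 3 * k ≡ 4 * suc k
  m+3≤4m = solve-∀
  n<[m+3]m : n < (m + 3) * m
  n<[m+3]m = <-≤-trans n<[2+k]² (≤-trans (m≤m+n _ k) (≤-reflexive ([2+k]²≡[m+3]m∸k k)))
  blocks≤4m : suc (n / m) ≤ 4 * m
  blocks≤4m = ≤-trans (m<n*o⇒m/o<n n<[m+3]m) (≤-trans (m≤m+n (m + 3) (3 * k)) (≤-reflexive (m+3≤4m k)))

mcs-count-cubic : (xs : List A) → 1 ≤ length xs → {L : List (ℕ × ℕ)} → Unique L → All (uncurry (IsMCS xs)) L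
                → length L * length L ≤ 36 * length xs ^ 3
mcs-count-cubic xs 1≤n {L} unique mcs with floor-sqrt (length xs)
... | zero , _ , n<1 = contradiction 1≤n (<⇒≱ n<1)
... | suc k , m²≤n , n<[1+m]² = begin
  length L * length L          ≤⟨ *-mono-≤ count≤ count≤ ⟩
  6 * (n * m) * (6 * (n * m))  ≡⟨ square≡ n m ⟩
  36 * (n * n * (m * m))       ≤⟨ *-monoʳ-≤ 36 (*-monoʳ-≤ (n * n) m²≤n) ⟩
  36 * (n * n * n)             ≡⟨ cube≡ n ⟩
  36 * n ^ 3                   ∎
  where
  open ≤-Reasoning
  n = length xs
  m = suc k
  count≤ : length L ≤ 6 * (n * m)
  count≤ = ≤-trans (MCSCount.mcs-count xs m unique mcs) (mcs-count≤6nm n k n<[1+m]²)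
  square≡ : ∀ n m → 6 * (n * m) * (6 * (n * m)) ≡ 36 * (n * n * (m * m))
  square≡ = solve-∀
  cube≡ : ∀ n → 36 * (n * n * n) ≡ 36 * (n * (n * (n * 1)))
  cube≡ = solve-∀

mainTheorem1 : ∃[ D ] (0 < D × (∀ (A : Set) (n : ℕ) → 1 ≤ n → (S : Vec A n)
                 → (L : List (ℕ × ℕ)) → Unique L
                 → All (uncurry (IsMCS (toList S))) L
                 → length L * length L ≤ D * n ^ 3))
mainTheorem1 = 36 , z<s , λ A n 1≤n S L unique mcs →
  subst (λ n → length L * length L ≤ 36 * n ^ 3) (length-toList S)
    (mcs-count-cubic (toList S) (subst (1 ≤_) (sym (length-toList S)) 1≤n) unique mcs)
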